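{- Let $d\ge 1$ and $\mathbf{b}=(b_1,\dots,b_d)\in\mathbb{Z}_{>0}^d$ with $\sum_{i=1}^d b_i$ even, and let $\beta=\frac12\sum_{i=1}^d b_i$. Then the polytope $$P_{\mathbf{b}}=[0,1]^{d+2}\cap\Big\{\mathbf{x}\in\mathbb{R}^{d+2} : \sum_{i=1}^d b_ix_i-\beta x_{d+1}+(\beta+\tfrac12)x_{d+2}\le\beta+\tfrac14\Big\}$$ is $(d+2)$-dimensional and simple.
   Context: A $D$-dimensional polytope is simple if every vertex lies on exactly $D$ facets.
   Formalization: The polytope $P_{\mathbf{b}}$ lies in ℚ^(d+2) rather than $\mathbb{R}^{d+2}$, and the inequalities cutting out its faces, vertices and facets, and the coefficients defining its dimension, are rational. -}

module Defs where

open import Data.Nat as ℕ using (ℕ; zero; suc)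
open import Data.Fin using (Fin; zero; suc; inject₁; fromℕ)
open import Data.Integer using (+_)
open import Data.Rational using (ℚ; 0ℚ; 1ℚ; _+_; _*_; _-_; _≤_; _/_)
open import Data.Product using (Σ; _×_; _,_)
open import Relation.Binary.PropositionalEquality using (_≡_)
open import Relation.Nullary using (¬_)
open import Data.Empty using (⊥)

-- Points of ℚ^D (all data of P_b is rational).
Point : ℕ → Set
Point D = Fin D → ℚ

Region : ℕ → Set₁
Region D = Point D → Set

∑ : ∀ {n} → (Fin n → ℚ) → ℚ
∑ {zero}  f = 0ℚ
∑ {suc n} f = f zero + ∑ (λ i → f (suc i))

∑ℕ : ∀ {n} → (Fin n → ℕ) → ℕ
∑ℕ {zero}  f = 0
∑ℕ {suc n} f = f zero ℕ.+ ∑ℕ (λ i → f (suc i))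

_·_ : ∀ {D} → Point D → Point D → ℚ
a · x = ∑ (λ i → a i * x i)

AffIndep : ∀ {D m} → (Fin m → Point D) → Set
AffIndep {D} {m} p =
  (λ′ : Fin m → ℚ) → ∑ λ′ ≡ 0ℚ → (∀ j → ∑ (λ i → λ′ i * p i j) ≡ 0ℚ) →
  ∀ i → λ′ i ≡ 0ℚ

HasAffIndep : ∀ {D} → Region D → ℕ → Set
HasAffIndep {D} S m = Σ (Fin m → Point D) λ p → (∀ i → S (p i)) × AffIndep p

HasDim : ∀ {D} → Region D → ℕ → Set
HasDim S k = HasAffIndep S (suc k) × ¬ HasAffIndep S (suc (suc k))

SameSet : ∀ {D} → Region D → Region D → Set
SameSet {D} S T = ∀ (x : Point D) → (S x → T x) × (T x → S x)

Ineq : ℕ → Set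
Ineq D = Point D × ℚ

Valid : ∀ {D} → Region D → Ineq D → Set
Valid P (a , c) = ∀ x → P x → (a · x) ≤ c

FaceOf : ∀ {D} → Region D → Ineq D → Region D
FaceOf P (a , c) x = P x × ((a · x) ≡ c)

IsFacet : ∀ {D} → Region D → Ineq D → Set
IsFacet {zero}  P h = Valid P h × HasDim (FaceOf P h) 0 × ⊥   -- a 0-dimensional polytope has no facets
IsFacet {suc D} P h = Valid P h × HasDim (FaceOf P h) D

IsVertex : ∀ {D} → Region D → Point D → Set
IsVertex {D} P v = Σ (Ineq D) λ h → Valid P h × FaceOf P h v ×
  (∀ x → FaceOf P h x → x ≡ v)

IsSimple : ∀ {D} → Region D → Set
IsSimple {D} P = ∀ v → IsVertex P v →
  Σ (Fin D → Ineq D) λ fs →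
    (∀ i → IsFacet P (fs i)) ×
    (∀ i → FaceOf P (fs i) v) ×
    (∀ i j → SameSet (FaceOf P (fs i)) (FaceOf P (fs j)) → i ≡ j) ×
    (∀ h → IsFacet P h → FaceOf P h v →
       Σ (Fin D) λ i → SameSet (FaceOf P h) (FaceOf P (fs i)))

Cube : ∀ D → Region D
Cube D x = ∀ i → (0ℚ ≤ x i) × (x i ≤ 1ℚ)

β : ∀ {d} → (Fin d → ℕ) → ℚ
β b = + (∑ℕ b) / 2

-- P_b ⊆ ℝ^{d+2}; coordinates x₁..x_d are indices inject₁ (inject₁ i),
-- x_{d+1} is inject₁ (fromℕ d), x_{d+2} is fromℕ (suc d).
Pb : ∀ d → (Fin d → ℕ) → Region (suc (suc d))
Pb d b x = Cube (suc (suc d)) x ×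
  ((∑ (λ i → (+ b i / 1) * x (inject₁ (inject₁ i)))
     - β b * x (inject₁ (fromℕ d))
     + (β b + + 1 / 2) * x (fromℕ (suc d)))
   ≤ β b + + 1 / 4)

module Submission where

-- P_b is the unit cube cut by one halfspace g · x ≤ r with r > 0, no zero entry in g, and no
-- 0/1 point on the hyperplane g · x = r: at 0/1 points g · x lies in ℤ ∪ (ℤ + ½) because β is an
-- integer, while r = β + ¼. Such a cut cube contains the origin and small multiples of all unit
-- vectors, so it is full-dimensional. At a vertex v either the cut is slack and v is a 0/1
-- point, or the cut is tight and exactly one coordinate m is fractional (with a second fractional
-- coordinate i, v could slide both ways along g_m e_i − g_i e_m). In both cases exactly n
-- constraints are tight at v, and there are edge directions leaving one of them while staying on
-- the others; v and the other edge points span each tight constraint, which is therefore a facet.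
-- Conversely every facet lies on a single constraint (otherwise the barycenter of its spanning
-- points is interior, forcing the facet inequality to be trivial), so these n are all the facets
-- through v.

open import Defs
open import Data.Nat as ℕ using (ℕ; zero; suc; _≥_; _>_)
import Data.Nat.Properties as ℕ
open import Data.Nat.Divisibility using (_∣_; divides)
open import Data.Fin as Fin using (Fin; zero; suc; punchIn; punchOut; inject₁; splitAt; _↑ˡ_; _↑ʳ_)
open import Data.Fin.Properties
  using (punchInᵢ≢i; punchIn-punchOut; splitAt-↑ˡ; splitAt-↑ʳ; any?; all?; ¬∀⟶∃¬)
open import Data.Vec.Functional using (_∷_; insertAt)
open import Data.Vec.Functional.Properties using (insertAt-lookup; insertAt-punchIn)
import Data.Integer as ℤ
import Data.Integer.Properties as ℤ
open import Data.Rational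
  using ( ℚ; 0ℚ; 1ℚ; _+_; _*_; -_; _-_; _/_; 1/_; _⊓_; _≤_; _<_; _≤?_; _<?_; _≟_; *≤*; *<*
        ; NonZero; Positive; ≢-nonZero; positive; negative; nonNegative; fromℚᵘ)
open import Data.Rational.Properties
open import Data.Rational.Solver using (module +-*-Solver)
import Data.Rational.Unnormalised as ℚᵘ
import Data.Rational.Unnormalised.Properties as ℚᵘ
open import Algebra.Properties.Group +-0-group using ()
  renaming ( x∙y⁻¹≈ε⇒x≈y to p-q≡0⇒p≡q; x≈y⇒x∙y⁻¹≈ε to p≡q⇒p-q≡0; ⁻¹-involutive to neg-involutive
           ; identityʳ-unique to p+q≡p⇒q≡0)
open import Data.Product using (Σ; _×_; _,_; proj₁; proj₂)
open import Data.Sum using (_⊎_; inj₁; inj₂)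
open import Data.Empty using (⊥-elim)
open import Function using (_∘_)
open import Relation.Nullary using (¬_; ¬?; Dec; yes; no)
open import Relation.Binary using (tri<; tri≈; tri>)
open import Relation.Binary.PropositionalEquality
open +-*-Solver

-- Finite sums

∑-cong : ∀ {n} {f g : Fin n → ℚ} → (∀ i → f i ≡ g i) → ∑ f ≡ ∑ g
∑-cong {zero}  f≗g = refl
∑-cong {suc n} f≗g = cong₂ _+_ (f≗g zero) (∑-cong (λ i → f≗g (suc i)))

∑-zero : ∀ {n} {f : Fin n → ℚ} → (∀ i → f i ≡ 0ℚ) → ∑ f ≡ 0ℚ
∑-zero {zero}  f≗0 = refl
∑-zero {suc n} f≗0 = cong₂ _+_ (f≗0 zero) (∑-zero (λ i → f≗0 (suc i)))

∑-distrib-+ : ∀ {n} (f g : Fin n → ℚ) → ∑ (λ i → f i + g i) ≡ ∑ f + ∑ g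
∑-distrib-+ {zero}  f g = refl
∑-distrib-+ {suc n} f g =
  trans (cong ((f zero + g zero) +_) (∑-distrib-+ (λ i → f (suc i)) (λ i → g (suc i))))
        (solve 4 (λ a b c d → (a :+ b) :+ (c :+ d) := (a :+ c) :+ (b :+ d)) refl (f zero) (g zero) _ _)

∑-scaleˡ : ∀ {n} (c : ℚ) (f : Fin n → ℚ) → ∑ (λ i → c * f i) ≡ c * ∑ f
∑-scaleˡ {zero}  c f = sym (*-zeroʳ c)
∑-scaleˡ {suc n} c f =
  trans (cong (c * f zero +_) (∑-scaleˡ c (λ i → f (suc i)))) (sym (*-distribˡ-+ c (f zero) _))

∑-scaleʳ : ∀ {n} (c : ℚ) (f : Fin n → ℚ) → ∑ (λ i → f i * c) ≡ ∑ f * c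
∑-scaleʳ c f = trans (∑-cong (λ i → *-comm (f i) c)) (trans (∑-scaleˡ c f) (*-comm c _))

∑-neg : ∀ {n} (f : Fin n → ℚ) → ∑ (λ i → - f i) ≡ - ∑ f
∑-neg {zero}  f = refl
∑-neg {suc n} f = trans (cong (- f zero +_) (∑-neg (λ i → f (suc i)))) (sym (neg-distrib-+ (f zero) _))

∑-comm : ∀ {m n} (f : Fin m → Fin n → ℚ) → ∑ (λ i → ∑ (f i)) ≡ ∑ (λ j → ∑ (λ i → f i j))
∑-comm {zero} {n} f = sym (∑-zero {n} (λ _ → refl))
∑-comm {suc m} f = trans (cong (∑ (f zero) +_) (∑-comm (λ i → f (suc i))))
                         (sym (∑-distrib-+ (f zero) (λ j → ∑ (λ i → f (suc i) j))))

∑-punchIn : ∀ {n} (f : Fin (suc n) → ℚ) (i : Fin (suc n)) → ∑ f ≡ f i + ∑ (λ j → f (punchIn i j))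
∑-punchIn         f zero    = refl
∑-punchIn {suc n} f (suc i) =
  trans (cong (f zero +_) (∑-punchIn (λ j → f (suc j)) i))
        (solve 3 (λ a b c → a :+ (b :+ c) := b :+ (a :+ c)) refl (f zero) (f (suc i)) _)

∑-single : ∀ {n} (f : Fin n → ℚ) (i : Fin n) → (∀ j → j ≢ i → f j ≡ 0ℚ) → ∑ f ≡ f i
∑-single {suc n} f i f≗0 =
  trans (∑-punchIn f i)
        (trans (cong (f i +_) (∑-zero (λ j → f≗0 (punchIn i j) (punchInᵢ≢i i j)))) (+-identityʳ (f i)))

∑-init-last : ∀ {n} (f : Fin (suc n) → ℚ) → ∑ f ≡ ∑ (λ i → f (inject₁ i)) + f (Fin.fromℕ n)
∑-init-last {zero}  f = trans (+-identityʳ (f zero)) (sym (+-identityˡ (f zero)))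
∑-init-last {suc n} f = trans (cong (f zero +_) (∑-init-last (λ i → f (suc i)))) (sym (+-assoc (f zero) _ _))

∑-mono-≤ : ∀ {n} {f g : Fin n → ℚ} → (∀ i → f i ≤ g i) → ∑ f ≤ ∑ g
∑-mono-≤ {zero}  f≤g = ≤-refl
∑-mono-≤ {suc n} f≤g = +-mono-≤ (f≤g zero) (∑-mono-≤ (λ i → f≤g (suc i)))

∑-mono-< : ∀ {n} {f g : Fin n → ℚ} → (∀ i → f i ≤ g i) → (k : Fin n) → f k < g k → ∑ f < ∑ g
∑-mono-< {suc n} {f} {g} f≤g k fk<gk =
  subst₂ _<_ (sym (∑-punchIn f k)) (sym (∑-punchIn g k))
         (+-mono-<-≤ fk<gk (∑-mono-≤ (λ j → f≤g (punchIn k j))))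

toℚ : ℕ → ℚ
toℚ zero    = 0ℚ
toℚ (suc n) = 1ℚ + toℚ n

0≤1 : 0ℚ ≤ 1ℚ
0≤1 = *≤* (ℤ.+≤+ ℕ.z≤n)

0<1 : 0ℚ < 1ℚ
0<1 = *<* (ℤ.+<+ (ℕ.s≤s ℕ.z≤n))

0≢1 : 0ℚ ≢ 1ℚ
0≢1 ()

-1≢0 : - 1ℚ ≢ 0ℚ
-1≢0 ()

toℚ-+ : ∀ m n → toℚ (m ℕ.+ n) ≡ toℚ m + toℚ n
toℚ-+ zero    n = sym (+-identityˡ (toℚ n))
toℚ-+ (suc m) n = trans (cong (1ℚ +_) (toℚ-+ m n)) (sym (+-assoc 1ℚ (toℚ m) (toℚ n)))

toℚ-mono-≤ : ∀ {m n} → m ℕ.≤ n → toℚ m ≤ toℚ n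
toℚ-mono-≤ {n = zero}  ℕ.z≤n = ≤-refl
toℚ-mono-≤ {n = suc n} ℕ.z≤n = ≤-trans (toℚ-mono-≤ {n = n} ℕ.z≤n)
  (subst (_≤ toℚ (suc n)) (+-identityˡ (toℚ n)) (+-monoˡ-≤ (toℚ n) 0≤1))
toℚ-mono-≤ (ℕ.s≤s m≤n) = +-monoʳ-≤ 1ℚ (toℚ-mono-≤ m≤n)

toℚ-pos : ∀ n → 0ℚ < toℚ (suc n)
toℚ-pos n = <-≤-trans 0<1 (subst (_≤ toℚ (suc n)) (+-identityʳ 1ℚ) (+-monoʳ-≤ 1ℚ (toℚ-mono-≤ {0} {n} ℕ.z≤n)))

∑-const : ∀ n (c : ℚ) → ∑ {n} (λ _ → c) ≡ toℚ n * c
∑-const zero    c = sym (*-zeroˡ c)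
∑-const (suc n) c = trans (cong (c +_) (∑-const n c))
  (trans (cong (_+ toℚ n * c) (sym (*-identityˡ c))) (sym (*-distribʳ-+ c 1ℚ (toℚ n))))

p*q≡0⇒p≡0 : ∀ p q → p * q ≡ 0ℚ → q ≢ 0ℚ → p ≡ 0ℚ
p*q≡0⇒p≡0 p q pq≡0 q≢0 = begin
  p               ≡⟨ sym (*-identityʳ p) ⟩
  p * 1ℚ          ≡⟨ cong (p *_) (sym (*-inverseʳ q)) ⟩
  p * (q * 1/ q)  ≡⟨ sym (*-assoc p q _) ⟩
  p * q * 1/ q    ≡⟨ cong (_* 1/ q) pq≡0 ⟩
  0ℚ * 1/ q       ≡⟨ *-zeroˡ (1/ q) ⟩
  0ℚ              ∎
  where open ≡-Reasoning; instance _ = ≢-nonZero q≢0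

p*q≡0⇒q≡0 : ∀ p q → p * q ≡ 0ℚ → p ≢ 0ℚ → q ≡ 0ℚ
p*q≡0⇒q≡0 p q pq≡0 = p*q≡0⇒p≡0 q p (trans (*-comm q p) pq≡0)

p≢0⇒0<p*p : ∀ p → p ≢ 0ℚ → 0ℚ < p * p
p≢0⇒0<p*p p p≢0 with <-cmp p 0ℚ
... | tri< p<0 _ _ = positive⁻¹ (p * p) {{neg*neg⇒pos p {{negative p<0}} p {{negative p<0}}}}
... | tri≈ _ p≡0 _ = ⊥-elim (p≢0 p≡0)
... | tri> _ _ p>0 = positive⁻¹ (p * p) {{pos*pos⇒pos p {{positive p>0}} p {{positive p>0}}}}

≤∧≢⇒< : ∀ {p q} → p ≤ q → p ≢ q → p < q
≤∧≢⇒< {p} {q} p≤q p≢q with <-cmp p q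
... | tri< p<q _ _ = p<q
... | tri≈ _ p≡q _ = ⊥-elim (p≢q p≡q)
... | tri> _ _ p>q = ⊥-elim (<-irrefl refl (<-≤-trans p>q p≤q))

-- Linear algebra over ℚ

infixl 6 _⊕_
infixl 7 _⊗_

_⊕_ : ∀ {n} → Point n → Point n → Point n
(x ⊕ y) i = x i + y i

_⊗_ : ∀ {n} → ℚ → Point n → Point n
(t ⊗ x) i = t * x i

𝟘 : ∀ {n} → Point n
𝟘 _ = 0ℚ

δ : ∀ {n} → Fin n → Point n
δ i j with i Fin.≟ j
... | yes _ = 1ℚ
... | no  _ = 0ℚ

δ-diag : ∀ {n} (i : Fin n) → δ i i ≡ 1ℚ
δ-diag i with i Fin.≟ i
... | yes _  = refl
... | no i≢i = ⊥-elim (i≢i refl)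

δ-offDiag : ∀ {n} {i j : Fin n} → i ≢ j → δ i j ≡ 0ℚ
δ-offDiag {i = i} {j} i≢j with i Fin.≟ j
... | yes i≡j = ⊥-elim (i≢j i≡j)
... | no  _   = refl

δ-nonNeg : ∀ {n} (i j : Fin n) → 0ℚ ≤ δ i j
δ-nonNeg i j with i Fin.≟ j
... | yes _ = 0≤1
... | no  _ = ≤-refl

·-comm : ∀ {n} (a x : Point n) → a · x ≡ x · a
·-comm a x = ∑-cong (λ i → *-comm (a i) (x i))

·-distrib-⊕ : ∀ {n} (a x y : Point n) → a · (x ⊕ y) ≡ a · x + a · y
·-distrib-⊕ a x y =
  trans (∑-cong (λ i → *-distribˡ-+ (a i) (x i) (y i))) (∑-distrib-+ (λ i → a i * x i) (λ i → a i * y i))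

·-⊗ : ∀ {n} (a : Point n) (t : ℚ) (x : Point n) → a · (t ⊗ x) ≡ t * (a · x)
·-⊗ a t x = trans (∑-cong (λ i → solve 3 (λ a t x → a :* (t :* x) := t :* (a :* x)) refl (a i) t (x i)))
                  (∑-scaleˡ t (λ i → a i * x i))

·-step : ∀ {n} (a y : Point n) (t : ℚ) (u : Point n) → a · (y ⊕ t ⊗ u) ≡ a · y + t * (a · u)
·-step a y t u = trans (·-distrib-⊕ a y (t ⊗ u)) (cong (a · y +_) (·-⊗ a t u))

·-𝟘 : ∀ {n} (a : Point n) → a · 𝟘 ≡ 0ℚ
·-𝟘 a = ∑-zero (λ i → *-zeroʳ (a i))

·-δ : ∀ {n} (a : Point n) (i : Fin n) → a · δ i ≡ a i
·-δ a i = trans (∑-single _ i (λ j j≢i → trans (cong (a j *_) (δ-offDiag (j≢i ∘ sym))) (*-zeroʳ (a j))))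
                (trans (cong (a i *_) (δ-diag i)) (*-identityʳ (a i)))

δ-· : ∀ {n} (i : Fin n) (x : Point n) → δ i · x ≡ x i
δ-· i x = trans (·-comm (δ i) x) (·-δ x i)

·-neg : ∀ {n} (a x : Point n) → (λ i → - a i) · x ≡ - (a · x)
·-neg a x = trans (∑-cong (λ i → sym (neg-distribˡ-* (a i) (x i)))) (∑-neg (λ i → a i * x i))

combination : ∀ {m n} → (Fin m → ℚ) → (Fin m → Point n) → Point n
combination c p j = ∑ (λ i → c i * p i j)

·-combination : ∀ {m n} (h : Point n) (c : Fin m → ℚ) (p : Fin m → Point n) →
  h · combination c p ≡ ∑ (λ i → c i * (h · p i))
·-combination h c p = begin
  ∑ (λ j → h j * ∑ (λ i → c i * p i j))      ≡⟨ ∑-cong (λ j → sym (∑-scaleˡ (h j) (λ i → c i * p i j))) ⟩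
  ∑ (λ j → ∑ (λ i → h j * (c i * p i j)))    ≡⟨ ∑-comm (λ j i → h j * (c i * p i j)) ⟩
  ∑ (λ i → ∑ (λ j → h j * (c i * p i j)))    ≡⟨ ∑-cong (λ i → ∑-cong (λ j → swap (h j) (c i) (p i j))) ⟩
  ∑ (λ i → ∑ (λ j → c i * (h j * p i j)))    ≡⟨ ∑-cong (λ i → ∑-scaleˡ (c i) (λ j → h j * p i j)) ⟩
  ∑ (λ i → c i * (h · p i))                  ∎
  where
  open ≡-Reasoning
  swap : ∀ a b x → a * (b * x) ≡ b * (a * x)
  swap = solve 3 (λ a b x → a :* (b :* x) := b :* (a :* x)) refl

LinearDependence : ∀ {m n} → (Fin m → Point n) → Set
LinearDependence {m} v =
  Σ (Fin m → ℚ) λ c → (Σ (Fin m) λ i → c i ≢ 0ℚ) × (∀ j → combination c v j ≡ 0ℚ)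

-- Gaussian elimination of the first coordinate, using row p as pivot: a dependence of the
-- reduced rows lifts to one of the original rows.
linearDependence-eliminate : ∀ {m n} (v : Fin (suc m) → Point (suc n)) (p : Fin (suc m)) (κ : Fin m → ℚ) →
  (∀ i → κ i * v p zero ≡ v (punchIn p i) zero) →
  LinearDependence (λ i j → v (punchIn p i) (suc j) - κ i * v p (suc j)) → LinearDependence v
linearDependence-eliminate {m} v p κ κ-pivot (μ , (q , μq≢0) , μ-dep) = c , (punchIn p q , cq≢0) , c-dep
  where
  S = ∑ (λ i → μ i * κ i)
  c = insertAt μ p (- S)
  cq≢0 : c (punchIn p q) ≢ 0ℚ
  cq≢0 cq≡0 = μq≢0 (trans (sym (insertAt-punchIn μ p (- S) q)) cq≡0)
  reduce : ∀ j → combination c v j ≡ ∑ (λ i → μ i * (v (punchIn p i) j - κ i * v p j))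
  reduce j = begin
    combination c v j
      ≡⟨ ∑-punchIn (λ i → c i * v i j) p ⟩
    c p * v p j + ∑ (λ i → c (punchIn p i) * v (punchIn p i) j)
      ≡⟨ cong₂ _+_ (cong (_* v p j) (insertAt-lookup μ p (- S)))
                   (∑-cong (λ i → cong (_* v (punchIn p i) j) (insertAt-punchIn μ p (- S) i))) ⟩
    - S * v p j + ∑ (λ i → μ i * v (punchIn p i) j)
      ≡⟨ cong (_+ ∑ (λ i → μ i * v (punchIn p i) j))
              (trans (sym (neg-distribˡ-* S (v p j))) (cong -_ (sym (∑-scaleʳ (v p j) (λ i → μ i * κ i))))) ⟩
    - ∑ (λ i → μ i * κ i * v p j) + ∑ (λ i → μ i * v (punchIn p i) j)
      ≡⟨ cong (_+ ∑ (λ i → μ i * v (punchIn p i) j)) (sym (∑-neg (λ i → μ i * κ i * v p j))) ⟩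
    ∑ (λ i → - (μ i * κ i * v p j)) + ∑ (λ i → μ i * v (punchIn p i) j)
      ≡⟨ sym (∑-distrib-+ (λ i → - (μ i * κ i * v p j)) (λ i → μ i * v (punchIn p i) j)) ⟩
    ∑ (λ i → - (μ i * κ i * v p j) + μ i * v (punchIn p i) j)
      ≡⟨ ∑-cong (λ i → solve 4 (λ m k a b → (:- (m :* k :* a)) :+ m :* b := m :* (b :- k :* a))
                                refl (μ i) (κ i) (v p j) (v (punchIn p i) j)) ⟩
    ∑ (λ i → μ i * (v (punchIn p i) j - κ i * v p j))
      ∎
    where open ≡-Reasoning
  c-dep : ∀ j → combination c v j ≡ 0ℚ
  c-dep zero    = trans (reduce zero) (∑-zero (λ i →
    trans (cong (λ z → μ i * (z - κ i * v p zero)) (sym (κ-pivot i)))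
          (trans (cong (μ i *_) (+-inverseʳ (κ i * v p zero))) (*-zeroʳ (μ i)))))
  c-dep (suc j) = trans (reduce (suc j)) (μ-dep j)

linearDependence : ∀ n (v : Fin (suc n) → Point n) → LinearDependence v
linearDependence zero    v = (λ _ → 1ℚ) , (zero , λ ()) , λ ()
linearDependence (suc n) v with any? (λ p → ¬? (v p zero ≟ 0ℚ))
... | yes (p , vp≢0) = linearDependence-eliminate v p κ κ-pivot
  (linearDependence n (λ i j → v (punchIn p i) (suc j) - κ i * v p (suc j)))
  where
  instance _ = ≢-nonZero vp≢0
  κ : Fin (suc n) → ℚ
  κ i = v (punchIn p i) zero * 1/ v p zero
  κ-pivot : ∀ i → κ i * v p zero ≡ v (punchIn p i) zero
  κ-pivot i = trans (*-assoc (v (punchIn p i) zero) (1/ v p zero) (v p zero))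
    (trans (cong (v (punchIn p i) zero *_) (*-inverseˡ (v p zero))) (*-identityʳ (v (punchIn p i) zero)))
... | no noPivot = linearDependence-eliminate v zero (λ _ → 0ℚ) zero-column
  (linearDependence n (λ i j → v (suc i) (suc j) - 0ℚ * v zero (suc j)))
  where
  zero-column : ∀ i → 0ℚ * v zero zero ≡ v (suc i) zero
  zero-column i with v (suc i) zero ≟ 0ℚ
  ... | yes vi≡0 = trans (*-zeroˡ (v zero zero)) (sym vi≡0)
  ... | no  vi≢0 = ⊥-elim (noPivot (suc i , vi≢0))

AffineDependence : ∀ {m n} → (Fin m → Point n) → Set
AffineDependence p = LinearDependence (λ i → 1ℚ ∷ p i)

affineDependence : ∀ {n} (p : Fin (suc (suc n)) → Point n) → AffineDependence p
affineDependence {n} p = linearDependence (suc n) (λ i → 1ℚ ∷ p i)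

affineDependence⇒¬affIndep : ∀ {m n} (p : Fin m → Point n) → AffineDependence p → ¬ AffIndep p
affineDependence⇒¬affIndep p (c , (i , ci≢0) , dep) indep =
  ci≢0 (indep c (trans (∑-cong (λ i → sym (*-identityʳ (c i)))) (dep zero)) (λ j → dep (suc j)) i)

¬affIndep-[2+n] : ∀ {n} (S : Region n) → ¬ HasAffIndep S (suc (suc n))
¬affIndep-[2+n] S (p , _ , indep) = affineDependence⇒¬affIndep p (affineDependence p) indep

-- Points of a hyperplane with h k ≢ 0 are affinely dependent as soon as their projections
-- forgetting coordinate k are, because that coordinate is an affine function of the others.
hyperplane-affineDependence : ∀ {n} (h : Point (suc n)) (b : ℚ) (k : Fin (suc n)) → h k ≢ 0ℚ →
  (p : Fin (suc (suc n)) → Point (suc n)) → (∀ i → h · p i ≡ b) → AffineDependence p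
hyperplane-affineDependence h b k hk≢0 p onH
  with affineDependence (λ i j → p i (punchIn k j))
... | c , nontrivial , dep = c , nontrivial , lift
  where
  Λ = combination c p
  ∑c≡0 : ∑ c ≡ 0ℚ
  ∑c≡0 = trans (∑-cong (λ i → sym (*-identityʳ (c i)))) (dep zero)
  hkΛk≡0 : h k * Λ k ≡ 0ℚ
  hkΛk≡0 = begin
    h k * Λ k
      ≡⟨ sym (+-identityʳ _) ⟩
    h k * Λ k + 0ℚ
      ≡⟨ cong (h k * Λ k +_) (sym (∑-zero (λ j →
           trans (cong (h (punchIn k j) *_) (dep (suc j))) (*-zeroʳ (h (punchIn k j)))))) ⟩
    h k * Λ k + ∑ (λ j → h (punchIn k j) * Λ (punchIn k j))
      ≡⟨ sym (∑-punchIn (λ j → h j * Λ j) k) ⟩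
    h · Λ
      ≡⟨ ·-combination h c p ⟩
    ∑ (λ i → c i * (h · p i))
      ≡⟨ ∑-cong (λ i → cong (c i *_) (onH i)) ⟩
    ∑ (λ i → c i * b)
      ≡⟨ ∑-scaleʳ b c ⟩
    ∑ c * b
      ≡⟨ cong (_* b) ∑c≡0 ⟩
    0ℚ * b
      ≡⟨ *-zeroˡ b ⟩
    0ℚ ∎
    where open ≡-Reasoning
  Λ≡0 : ∀ j → Λ j ≡ 0ℚ
  Λ≡0 j with k Fin.≟ j
  ... | yes refl = p*q≡0⇒q≡0 (h k) (Λ k) hkΛk≡0 hk≢0
  ... | no  k≢j  = subst (λ j → Λ j ≡ 0ℚ) (punchIn-punchOut k≢j) (dep (suc (punchOut k≢j)))
  lift : ∀ j → combination c (λ i → 1ℚ ∷ p i) j ≡ 0ℚ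
  lift zero    = dep zero
  lift (suc j) = Λ≡0 j

hyperplane-¬affIndep : ∀ {n} (S : Region (suc n)) (h : Point (suc n)) (b : ℚ) (k : Fin (suc n)) →
  h k ≢ 0ℚ → (∀ x → S x → h · x ≡ b) → ¬ HasAffIndep S (suc (suc n))
hyperplane-¬affIndep S h b k hk≢0 onH (p , p∈S , indep) =
  affineDependence⇒¬affIndep p (hyperplane-affineDependence h b k hk≢0 p (λ i → onH (p i) (p∈S i))) indep

affineRelation-annihilates : ∀ {m n} (c : Fin m → ℚ) (p : Fin m → Point n) (h : Point n) (b : ℚ) →
  ∑ c ≡ 0ℚ → (∀ j → combination c p j ≡ 0ℚ) → ∑ (λ i → c i * (h · p i - b)) ≡ 0ℚ
affineRelation-annihilates c p h b ∑c≡0 comb≡0 = begin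
  ∑ (λ i → c i * (h · p i - b))
    ≡⟨ ∑-cong (λ i → solve 3 (λ c x b → c :* (x :- b) := c :* x :+ (:- (b :* c))) refl (c i) (h · p i) b) ⟩
  ∑ (λ i → c i * (h · p i) + - (b * c i))
    ≡⟨ ∑-distrib-+ (λ i → c i * (h · p i)) (λ i → - (b * c i)) ⟩
  ∑ (λ i → c i * (h · p i)) + ∑ (λ i → - (b * c i))
    ≡⟨ cong₂ _+_ (sym (·-combination h c p)) (trans (∑-neg (λ i → b * c i)) (cong -_ (∑-scaleˡ b c))) ⟩
  h · combination c p + - (b * ∑ c)
    ≡⟨ cong₂ (λ x y → x + - (b * y)) (∑-zero (λ j → trans (cong (h j *_) (comb≡0 j)) (*-zeroʳ (h j)))) ∑c≡0 ⟩
  0ℚ + - (b * 0ℚ)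
    ≡⟨ solve 1 (λ b → con 0ℚ :+ (:- (b :* con 0ℚ)) := con 0ℚ) refl b ⟩
  0ℚ ∎
  where open ≡-Reasoning

Separates : ∀ {m n} → Point n → ℚ → (Fin m → Point n) → Fin m → Set
Separates h b p l = (∀ k → k ≢ l → h · p k ≡ b) × h · p l ≢ b

affineRelation-separated : ∀ {m n} (c : Fin m → ℚ) (p : Fin m → Point n) (h : Point n) (b : ℚ) (l : Fin m) →
  ∑ c ≡ 0ℚ → (∀ j → combination c p j ≡ 0ℚ) → Separates h b p l → c l ≡ 0ℚ
affineRelation-separated c p h b l ∑c≡0 comb≡0 (on , off) =
  p*q≡0⇒p≡0 (c l) (h · p l - b)
    (trans (sym (∑-single (λ i → c i * (h · p i - b)) l (λ k k≢l →
                  trans (cong (c k *_) (p≡q⇒p-q≡0 (on k k≢l))) (*-zeroʳ (c k)))))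
           (affineRelation-annihilates c p h b ∑c≡0 comb≡0))
    (λ eq → off (p-q≡0⇒p≡q (h · p l) b eq))

affIndep-bySeparation : ∀ {m n} (p : Fin m → Point n) (i : Fin m) →
  (∀ l → l ≢ i → Σ (Point n) λ h → Σ ℚ λ b → Separates h b p l) → AffIndep p
affIndep-bySeparation p i separate c ∑c≡0 comb≡0 = c≡0
  where
  c≢i≡0 : ∀ l → l ≢ i → c l ≡ 0ℚ
  c≢i≡0 l l≢i with separate l l≢i
  ... | h , b , sep = affineRelation-separated c p h b l ∑c≡0 comb≡0 sep
  c≡0 : ∀ l → c l ≡ 0ℚ
  c≡0 l with l Fin.≟ i
  ... | yes refl = trans (sym (∑-single c l c≢i≡0)) ∑c≡0
  ... | no  l≢i  = c≢i≡0 l l≢i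

affIndep-∷ : ∀ {m n} (p : Fin m → Point n) (h : Point n) (b : ℚ) (x : Point n) →
  AffIndep p → (∀ k → h · p k ≡ b) → h · x ≢ b → AffIndep (x ∷ p)
affIndep-∷ p h b x indep on off c ∑c≡0 comb≡0 = c≡0
  where
  c₀≡0 : c zero ≡ 0ℚ
  c₀≡0 = affineRelation-separated c (x ∷ p) h b zero ∑c≡0 comb≡0 (on′ , off)
    where
    on′ : ∀ k → k ≢ zero → h · (x ∷ p) k ≡ b
    on′ zero    k≢0 = ⊥-elim (k≢0 refl)
    on′ (suc k) _   = on k
  dropFirst : ∀ {s t} → s + t ≡ 0ℚ → s ≡ 0ℚ → t ≡ 0ℚ
  dropFirst {s} {t} s+t≡0 s≡0 = trans (sym (+-identityˡ t)) (trans (cong (_+ t) (sym s≡0)) s+t≡0)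
  c≡0 : ∀ l → c l ≡ 0ℚ
  c≡0 zero    = c₀≡0
  c≡0 (suc l) = indep (λ k → c (suc k)) (dropFirst ∑c≡0 c₀≡0)
    (λ j → dropFirst (comb≡0 j) (trans (cong (_* x j) c₀≡0) (*-zeroˡ (x j)))) l

0≤s∧γ≤0⇒α+sγ≤α : ∀ {α s γ} → 0ℚ ≤ s → γ ≤ 0ℚ → α + s * γ ≤ α
0≤s∧γ≤0⇒α+sγ≤α {α} {s} {γ} 0≤s γ≤0 = subst (α + s * γ ≤_) (+-identityʳ α)
  (+-monoʳ-≤ α (subst (s * γ ≤_) (*-zeroʳ s) (*-monoˡ-≤-nonNeg s {{nonNegative 0≤s}} γ≤0)))

0<t∧c+ts≤c⇒s≤0 : ∀ {c t s} → 0ℚ < t → c + t * s ≤ c → s ≤ 0ℚ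
0<t∧c+ts≤c⇒s≤0 {c} {t} {s} 0<t c+ts≤c with s ≤? 0ℚ
... | yes s≤0 = s≤0
... | no  s≰0 = ⊥-elim (<-irrefl refl (<-≤-trans c<c+ts c+ts≤c))
  where
  c<c+ts : c < c + t * s
  c<c+ts = subst (_< c + t * s) (+-identityʳ c)
    (+-monoʳ-< c (positive⁻¹ (t * s) {{pos*pos⇒pos t {{positive 0<t}} s {{positive (≰⇒> s≰0)}}}}))

-- The admissible step sizes contain an interval [0, t], so finitely many constraints combine via ⊓.
stepBound : ∀ {α c γ} → α ≤ c → (α ≡ c → γ ≤ 0ℚ) →
  Σ ℚ λ t → 0ℚ < t × (∀ s → 0ℚ ≤ s → s ≤ t → α + s * γ ≤ c)
stepBound {α} {c} {γ} α≤c tight⇒γ≤0 with γ ≤? 0ℚ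
... | yes γ≤0 = 1ℚ , 0<1 , λ s 0≤s _ → ≤-trans (0≤s∧γ≤0⇒α+sγ≤α 0≤s γ≤0) α≤c
... | no  γ≰0 = t , 0<t , admissible
  where
  0<γ : 0ℚ < γ
  0<γ = ≰⇒> γ≰0
  instance
    γ-pos : Positive γ
    γ-pos = positive 0<γ
    γ-nonZero : NonZero γ
    γ-nonZero = pos⇒nonZero γ
  t = (c - α) * 1/ γ
  0<t : 0ℚ < t
  0<t = positive⁻¹ t {{pos*pos⇒pos (c - α) {{positive α<c′}} (1/ γ) {{1/pos⇒pos γ}}}}
    where
    α<c′ : 0ℚ < c - α
    α<c′ = subst (_< c - α) (+-inverseʳ α)
      (+-monoˡ-< (- α) (≤∧≢⇒< α≤c (λ α≡c → <-irrefl refl (<-≤-trans 0<γ (tight⇒γ≤0 α≡c)))))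
  tγ≡c-α : t * γ ≡ c - α
  tγ≡c-α = trans (*-assoc (c - α) (1/ γ) γ) (trans (cong ((c - α) *_) (*-inverseˡ γ)) (*-identityʳ (c - α)))
  admissible : ∀ s → 0ℚ ≤ s → s ≤ t → α + s * γ ≤ c
  admissible s _ s≤t = subst (α + s * γ ≤_)
    (trans (cong (α +_) tγ≡c-α) (solve 2 (λ a c → a :+ (c :- a) := c) refl α c))
    (+-monoʳ-≤ α (*-monoʳ-≤-nonNeg γ {{nonNegative (<⇒≤ 0<γ)}} s≤t))

feasibleStep : ∀ {m} (α c γ : Fin m → ℚ) → (∀ k → α k ≤ c k) → (∀ k → α k ≡ c k → γ k ≤ 0ℚ) →
  Σ ℚ λ t → 0ℚ < t × (∀ s → 0ℚ ≤ s → s ≤ t → ∀ k → α k + s * γ k ≤ c k)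
feasibleStep {zero}  α c γ _ _ = 1ℚ , 0<1 , λ _ _ _ ()
feasibleStep {suc m} α c γ α≤c tight⇒γ≤0
  with stepBound (α≤c zero) (tight⇒γ≤0 zero)
     | feasibleStep (λ k → α (suc k)) (λ k → c (suc k)) (λ k → γ (suc k)) (λ k → α≤c (suc k)) (λ k → tight⇒γ≤0 (suc k))
... | t₀ , 0<t₀ , ok₀ | t′ , 0<t′ , ok′ = t₀ ⊓ t′ , 0<t₀⊓t′ , ok
  where
  0<t₀⊓t′ : 0ℚ < t₀ ⊓ t′
  0<t₀⊓t′ with ⊓-sel t₀ t′
  ... | inj₁ eq = subst (0ℚ <_) (sym eq) 0<t₀
  ... | inj₂ eq = subst (0ℚ <_) (sym eq) 0<t′
  ok : ∀ s → 0ℚ ≤ s → s ≤ t₀ ⊓ t′ → ∀ k → α k + s * γ k ≤ c k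
  ok s 0≤s s≤t zero    = ok₀ s 0≤s (≤-trans s≤t (p⊓q≤p t₀ t′))
  ok s 0≤s s≤t (suc k) = ok′ s 0≤s (≤-trans s≤t (p⊓q≤q t₀ t′)) k

-- The unit cube cut by a halfspace

Is01 : ℚ → Set
Is01 x = x ≡ 0ℚ ⊎ x ≡ 1ℚ

Fractional : ℚ → Set
Fractional x = 0ℚ < x × x < 1ℚ

fractional? : ∀ x → Dec (Fractional x)
fractional? x with 0ℚ <? x | x <? 1ℚ
... | yes 0<x | yes x<1 = yes (0<x , x<1)
... | no  0≮x | _       = no (0≮x ∘ proj₁)
... | _       | no  x≮1 = no (x≮1 ∘ proj₂)

¬fractional⇒01 : ∀ {x} → 0ℚ ≤ x → x ≤ 1ℚ → ¬ Fractional x → Is01 x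
¬fractional⇒01 {x} 0≤x x≤1 ¬frac with 0ℚ ≟ x | x ≟ 1ℚ
... | yes 0≡x | _       = inj₁ (sym 0≡x)
... | _       | yes x≡1 = inj₂ x≡1
... | no  0≢x | no  x≢1 = ⊥-elim (¬frac (≤∧≢⇒< 0≤x 0≢x , ≤∧≢⇒< x≤1 x≢1))

module CubeCut {n′ : ℕ} (g : Point (suc n′)) (r : ℚ) (g≢0 : ∀ i → g i ≢ 0ℚ) (0<r : 0ℚ < r)
  (cut-avoids-01 : ∀ x → (∀ i → Is01 (x i)) → g · x ≢ r) where

  n : ℕ
  n = suc n′

  data Constraint : Set where
    lower upper : Fin n → Constraint
    cut         : Constraint

  normal : Constraint → Point n
  normal (lower i) j = - δ i j
  normal (upper i)   = δ i
  normal cut         = g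

  bound : Constraint → ℚ
  bound (lower _) = 0ℚ
  bound (upper _) = 1ℚ
  bound cut       = r

  P : Region n
  P x = ∀ C → normal C · x ≤ bound C

  Tight : Point n → Constraint → Set
  Tight x C = normal C · x ≡ bound C

  Strict : Point n → Constraint → Set
  Strict x C = normal C · x < bound C

  Face : Constraint → Region n
  Face C = FaceOf P (normal C , bound C)

  lower-· : ∀ i x → normal (lower i) · x ≡ - x i
  lower-· i x = trans (·-neg (δ i) x) (cong -_ (δ-· i x))

  upper-· : ∀ i x → normal (upper i) · x ≡ x i
  upper-· = δ-·

  P⊆Cube : ∀ x → P x → Cube n x
  P⊆Cube x x∈P i =
    subst (0ℚ ≤_) (neg-involutive (x i)) (neg-antimono-≤ (subst (_≤ 0ℚ) (lower-· i x) (x∈P (lower i)))) ,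
    subst (_≤ 1ℚ) (upper-· i x) (x∈P (upper i))

  normal-nonZero : ∀ C → Σ (Fin n) λ k → normal C k ≢ 0ℚ
  normal-nonZero (lower i) = i , λ eq → -1≢0 (trans (sym (cong -_ (δ-diag i))) eq)
  normal-nonZero (upper i) = i , λ eq → 1≢0 (trans (sym (δ-diag i)) eq)
  normal-nonZero cut       = zero , g≢0 zero

  constraint : Fin (suc (n ℕ.+ n)) → Constraint
  constraint zero = cut
  constraint (suc j) with splitAt n j
  ... | inj₁ i = lower i
  ... | inj₂ i = upper i

  constraint-surjective : ∀ C → Σ (Fin (suc (n ℕ.+ n))) λ j → constraint j ≡ C
  constraint-surjective (lower i) = suc (i ↑ˡ n) , cong-splitAt
    where
    cong-splitAt : constraint (suc (i ↑ˡ n)) ≡ lower i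
    cong-splitAt rewrite splitAt-↑ˡ n i n = refl
  constraint-surjective (upper i) = suc (n ↑ʳ i) , cong-splitAt
    where
    cong-splitAt : constraint (suc (n ↑ʳ i)) ≡ upper i
    cong-splitAt rewrite splitAt-↑ʳ n n i = refl
  constraint-surjective cut = zero , refl

  feasibleDirection : ∀ y u → P y → (∀ C → Tight y C → normal C · u ≤ 0ℚ) →
    Σ ℚ λ t → 0ℚ < t × P (y ⊕ t ⊗ u)
  feasibleDirection y u y∈P tight⇒≤0
    with feasibleStep (λ j → normal (constraint j) · y) (λ j → bound (constraint j)) (λ j → normal (constraint j) · u)
                      (λ j → y∈P (constraint j)) (λ j → tight⇒≤0 (constraint j))
  ... | t , 0<t , ok = t , 0<t , λ C → satisfies C (constraint-surjective C)
    where
    satisfies : ∀ C → Σ _ (λ j → constraint j ≡ C) → normal C · (y ⊕ t ⊗ u) ≤ bound C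
    satisfies C (j , refl) = subst (_≤ bound C) (sym (·-step (normal C) y t u)) (ok t (<⇒≤ 0<t) ≤-refl j)

  0∈P : P 𝟘
  0∈P C = subst (_≤ bound C) (sym (·-𝟘 (normal C))) (0≤bound C)
    where
    0≤bound : ∀ C → 0ℚ ≤ bound C
    0≤bound (lower _) = ≤-refl
    0≤bound (upper _) = 0≤1
    0≤bound cut       = <⇒≤ 0<r

  axisStep : ∀ j → Σ ℚ λ t → 0ℚ < t × P (𝟘 ⊕ t ⊗ δ j)
  axisStep j = feasibleDirection 𝟘 (δ j) 0∈P tight⇒≤0
    where
    tight⇒≤0 : ∀ C → Tight 𝟘 C → normal C · δ j ≤ 0ℚ
    tight⇒≤0 (lower i) _ = subst (_≤ 0ℚ) (sym (lower-· i (δ j))) (neg-antimono-≤ (δ-nonNeg j i))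
    tight⇒≤0 (upper i) t = ⊥-elim (0≢1 (trans (sym (·-𝟘 (δ i))) t))
    tight⇒≤0 cut       t = ⊥-elim (<-irrefl (trans (sym (·-𝟘 g)) t) 0<r)

  simplex : Fin (suc n) → Point n
  simplex zero    = 𝟘
  simplex (suc j) = 𝟘 ⊕ proj₁ (axisStep j) ⊗ δ j

  simplex⊆P : ∀ k → P (simplex k)
  simplex⊆P zero    = 0∈P
  simplex⊆P (suc j) = proj₂ (proj₂ (axisStep j))

  simplex-affIndep : AffIndep simplex
  simplex-affIndep = affIndep-bySeparation simplex zero separate
    where
    coord : ∀ j i → δ i · simplex (suc j) ≡ proj₁ (axisStep j) * δ j i
    coord j i = trans (δ-· i (simplex (suc j))) (+-identityˡ _)
    separate : ∀ l → l ≢ zero → Σ (Point n) λ h → Σ ℚ λ b → Separates h b simplex l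
    separate zero    l≢0 = ⊥-elim (l≢0 refl)
    separate (suc j) _   = δ j , 0ℚ , on , off
      where
      on : ∀ k → k ≢ suc j → δ j · simplex k ≡ 0ℚ
      on zero     _   = ·-𝟘 (δ j)
      on (suc j′) k≢l = trans (coord j′ j)
        (trans (cong (proj₁ (axisStep j′) *_) (δ-offDiag (λ j′≡j → k≢l (cong suc j′≡j)))) (*-zeroʳ (proj₁ (axisStep j′))))
      t = proj₁ (axisStep j)
      off : δ j · simplex (suc j) ≢ 0ℚ
      off eq = <-irrefl (sym t≡0) (proj₁ (proj₂ (axisStep j)))
        where
        t≡0 : t ≡ 0ℚ
        t≡0 = trans (sym (trans (coord j j) (trans (cong (t *_) (δ-diag j)) (*-identityʳ t)))) eq

  P-fullDim : HasDim P n
  P-fullDim = (simplex , simplex⊆P , simplex-affIndep) , ¬affIndep-[2+n] P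

  Interior : Point n → Set
  Interior y = ∀ C → Strict y C

  tight? : ∀ x C → Dec (Tight x C)
  tight? x C = normal C · x ≟ bound C

  -- Every direction is feasible at an interior point, so a valid inequality that is tight
  -- there cannot increase in any coordinate direction.
  tightAtInterior⇒trivial : ∀ a c y → Valid P (a , c) → Interior y → a · y ≡ c → ∀ j → a j ≡ 0ℚ
  tightAtInterior⇒trivial a c y valid y° ay≡c j with a j ≟ 0ℚ
  ... | yes aj≡0 = aj≡0
  ... | no  aj≢0 with feasibleDirection y (a j ⊗ δ j) (λ C → <⇒≤ (y° C)) (λ C t → ⊥-elim (<-irrefl t (y° C)))
  ...   | t , 0<t , z∈P = ⊥-elim (<-irrefl refl (<-≤-trans c<az (subst (_≤ c) az≡ (valid (y ⊕ t ⊗ (a j ⊗ δ j)) z∈P))))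
    where
    az≡ : a · (y ⊕ t ⊗ (a j ⊗ δ j)) ≡ c + t * (a j * a j)
    az≡ = trans (·-step a y t (a j ⊗ δ j))
                (cong₂ (λ u w → u + t * w) ay≡c (trans (·-⊗ a (a j) (δ j)) (cong (a j *_) (·-δ a j))))
    c<az : c < c + t * (a j * a j)
    c<az = subst (_< c + t * (a j * a j)) (+-identityʳ c)
      (+-monoʳ-< c (positive⁻¹ _ {{pos*pos⇒pos t {{positive 0<t}} (a j * a j) {{positive (p≢0⇒0<p*p (a j) aj≢0)}}}}))

  module _ where
    private
      N : ℚ
      N = toℚ n
      instance
        N-pos : Positive N
        N-pos = positive (toℚ-pos n′)
        N-nonZero : NonZero N
        N-nonZero = pos⇒nonZero N

    barycenter : (Fin n → Point n) → Point n
    barycenter p = (1/ N) ⊗ (λ j → ∑ (λ k → p k j))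

    ·-barycenter : ∀ b p → b · barycenter p ≡ 1/ N * ∑ (λ k → b · p k)
    ·-barycenter b p = trans (·-⊗ b (1/ N) (λ j → ∑ (λ k → p k j)))
      (cong (1/ N *_) (trans (∑-cong (λ j → sym (∑-scaleˡ (b j) (λ k → p k j)))) (∑-comm (λ j k → b j * p k j))))

    mean-const : ∀ c → 1/ N * ∑ {n} (λ _ → c) ≡ c
    mean-const c = trans (cong (1/ N *_) (∑-const n c))
      (trans (sym (*-assoc (1/ N) N c)) (trans (cong (_* c) (*-inverseˡ N)) (*-identityˡ c)))

    barycenter-on : ∀ a c p → (∀ k → a · p k ≡ c) → a · barycenter p ≡ c
    barycenter-on a c p on = trans (·-barycenter a p) (trans (cong (1/ N *_) (∑-cong on)) (mean-const c))

    barycenter-interior : ∀ p → (∀ k → P (p k)) → (∀ C → Σ (Fin n) λ k → Strict (p k) C) →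
      Interior (barycenter p)
    barycenter-interior p p∈P someStrict C with someStrict C
    ... | k , strict = subst₂ _<_ (sym (·-barycenter (normal C) p)) (mean-const (bound C))
      (*-monoʳ-<-pos (1/ N) {{1/pos⇒pos N}}
        (∑-mono-< (λ k → p∈P k C) k strict))

  commonTight? : (p : Fin n → Point n) → Dec (Σ Constraint λ C → ∀ k → Tight (p k) C)
  commonTight? p with any? (λ j → all? (λ k → tight? (p k) (constraint j)))
  ... | yes (j , on) = yes (constraint j , on)
  ... | no  none     = no λ { (C , on) → none (lift C (constraint-surjective C) on) }
    where
    lift : ∀ C → Σ _ (λ j → constraint j ≡ C) → (∀ k → Tight (p k) C) → Σ _ λ j → ∀ k → Tight (p k) (constraint j)
    lift C (j , refl) on = j , on

  -- Otherwise the barycenter of p is interior, so the facet inequality is trivial and the facet is all of P.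
  facetPoints-commonTight : ∀ a c → IsFacet P (a , c) → (p : Fin n → Point n) → (∀ k → FaceOf P (a , c) (p k)) →
    Σ Constraint λ C → ∀ k → Tight (p k) C
  facetPoints-commonTight a c (valid , _ , ¬indep) p p∈F with commonTight? p
  ... | yes common = common
  ... | no  none   = ⊥-elim (¬indep (simplex , (λ k → simplex⊆P k , onFace (simplex k)) , simplex-affIndep))
    where
    someStrict : ∀ C → Σ (Fin n) λ k → Strict (p k) C
    someStrict C with ¬∀⟶∃¬ n (λ k → Tight (p k) C) (λ k → tight? (p k) C) (λ on → none (C , on))
    ... | k , ¬tight = k , ≤∧≢⇒< (proj₁ (p∈F k) C) ¬tight
    y = barycenter p
    a≡0 : ∀ j → a j ≡ 0ℚ
    a≡0 = tightAtInterior⇒trivial a c y valid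
      (barycenter-interior p (λ k → proj₁ (p∈F k)) someStrict) (barycenter-on a c p (λ k → proj₂ (p∈F k)))
    a·≡0 : ∀ x → a · x ≡ 0ℚ
    a·≡0 x = ∑-zero (λ i → trans (cong (_* x i) (a≡0 i)) (*-zeroˡ (x i)))
    onFace : ∀ x → a · x ≡ c
    onFace x = trans (a·≡0 x) (trans (sym (a·≡0 (p zero))) (proj₂ (p∈F zero)))

  face-¬affIndep : ∀ C → ¬ HasAffIndep (Face C) (suc n)
  face-¬affIndep C = hyperplane-¬affIndep (Face C) (normal C) (bound C)
    (proj₁ (normal-nonZero C)) (proj₂ (normal-nonZero C)) (λ _ → proj₂)

  facet-constraintFace : ∀ h → IsFacet P h → Σ Constraint λ C → SameSet (FaceOf P h) (Face C)
  facet-constraintFace (a , c) facet@(valid , (p , p∈F , p-indep) , ¬indep)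
    with facetPoints-commonTight a c facet p p∈F
  ... | C , onC = C , λ x → F⊆FC x , FC⊆F x
    where
    F⊆FC : ∀ x → FaceOf P (a , c) x → Face C x
    F⊆FC x (x∈P , ax≡c) with tight? x C
    ... | yes tight = x∈P , tight
    ... | no  slack = ⊥-elim (¬indep (x ∷ p , x∷p∈F , affIndep-∷ p (normal C) (bound C) x p-indep onC slack))
      where
      x∷p∈F : ∀ k → FaceOf P (a , c) ((x ∷ p) k)
      x∷p∈F zero    = x∈P , ax≡c
      x∷p∈F (suc k) = p∈F k
    FC⊆F : ∀ x → Face C x → FaceOf P (a , c) x
    FC⊆F x (x∈P , tight) with a · x ≟ c
    ... | yes ax≡c = x∈P , ax≡c
    ... | no  ax≢c = ⊥-elim (face-¬affIndep C
                       (x ∷ p , x∷p∈FC , affIndep-∷ p a c x p-indep (λ k → proj₂ (p∈F k)) ax≢c))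
      where
      x∷p∈FC : ∀ k → Face C ((x ∷ p) k)
      x∷p∈FC zero    = x∈P , tight
      x∷p∈FC (suc k) = proj₁ (p∈F k) , onC k

  -- Up to sign, the edge directions form the dual basis of the normals of the tight constraints.
  record NondegenerateVertex (v : Point n) : Set where
    field
      v∈P            : P v
      tight          : Fin n → Constraint
      tight-isTight  : ∀ i → Tight v (tight i)
      tight-complete : ∀ C → Tight v C → Σ (Fin n) λ i → tight i ≡ C
      edge           : Fin n → Point n
      edge-stays     : ∀ l k → l ≢ k → normal (tight l) · edge k ≡ 0ℚ
      edge-leaves    : ∀ k → normal (tight k) · edge k < 0ℚ

  module NondegenerateVertexFacets {v : Point n} (nv : NondegenerateVertex v) where
    open NondegenerateVertex nv

    edgeStep : ∀ k → Σ ℚ λ t → 0ℚ < t × P (v ⊕ t ⊗ edge k)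
    edgeStep k = feasibleDirection v (edge k) v∈P (λ C tightC → nonIncreasing C (tight-complete C tightC))
      where
      nonIncreasing : ∀ C → Σ (Fin n) (λ l → tight l ≡ C) → normal C · edge k ≤ 0ℚ
      nonIncreasing _ (l , refl) with l Fin.≟ k
      ... | yes refl = <⇒≤ (edge-leaves l)
      ... | no  l≢k  = ≤-reflexive (edge-stays l k l≢k)

    edgeLength : Fin n → ℚ
    edgeLength k = proj₁ (edgeStep k)

    edgePoint : Fin n → Point n
    edgePoint k = v ⊕ edgeLength k ⊗ edge k

    ·-edgePoint : ∀ l k → normal (tight l) · edgePoint k ≡ bound (tight l) + edgeLength k * (normal (tight l) · edge k)
    ·-edgePoint l k = trans (·-step (normal (tight l)) v (edgeLength k) (edge k))
                            (cong (_+ edgeLength k * (normal (tight l) · edge k)) (tight-isTight l))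

    edgePoint-tight : ∀ l k → l ≢ k → Tight (edgePoint k) (tight l)
    edgePoint-tight l k l≢k = trans (·-edgePoint l k)
      (trans (cong (λ z → bound (tight l) + edgeLength k * z) (edge-stays l k l≢k))
             (trans (cong (bound (tight l) +_) (*-zeroʳ (edgeLength k))) (+-identityʳ (bound (tight l)))))

    edgePoint-strict : ∀ k → Strict (edgePoint k) (tight k)
    edgePoint-strict k = subst (_< b) (sym (·-edgePoint k k))
      (subst (b + edgeLength k * γ <_) (+-identityʳ b)
        (+-monoʳ-< b (subst (edgeLength k * γ <_) (*-zeroʳ (edgeLength k))
          (*-monoʳ-<-pos (edgeLength k) {{positive (proj₁ (proj₂ (edgeStep k)))}} (edge-leaves k)))))
      where
      b = bound (tight k)
      γ = normal (tight k) · edge k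

    facetPoint : Fin n → Fin n → Point n
    facetPoint i k with k Fin.≟ i
    ... | yes _ = v
    ... | no  _ = edgePoint k

    facetPoint-∈P : ∀ i k → P (facetPoint i k)
    facetPoint-∈P i k with k Fin.≟ i
    ... | yes _ = v∈P
    ... | no  _ = proj₂ (proj₂ (edgeStep k))

    facetPoint-onFacet : ∀ i k → Tight (facetPoint i k) (tight i)
    facetPoint-onFacet i k with k Fin.≟ i
    ... | yes _   = tight-isTight i
    ... | no  k≢i = edgePoint-tight i k (k≢i ∘ sym)

    facetPoint-tight : ∀ i l k → k ≢ l → Tight (facetPoint i k) (tight l)
    facetPoint-tight i l k k≢l with k Fin.≟ i
    ... | yes _ = tight-isTight l
    ... | no  _ = edgePoint-tight l k (k≢l ∘ sym)

    facetPoint-strict : ∀ i l → l ≢ i → Strict (facetPoint i l) (tight l)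
    facetPoint-strict i l l≢i with l Fin.≟ i
    ... | yes l≡i = ⊥-elim (l≢i l≡i)
    ... | no  _   = edgePoint-strict l

    facetPoint-affIndep : ∀ i → AffIndep (facetPoint i)
    facetPoint-affIndep i = affIndep-bySeparation (facetPoint i) i λ l l≢i →
      normal (tight l) , bound (tight l) ,
      (λ k k≢l → facetPoint-tight i l k k≢l) , λ tight → <-irrefl tight (facetPoint-strict i l l≢i)

    tight-isFacet : ∀ i → IsFacet P (normal (tight i) , bound (tight i))
    tight-isFacet i = (λ x x∈P → x∈P (tight i)) ,
      (facetPoint i , (λ k → facetPoint-∈P i k , facetPoint-onFacet i k) , facetPoint-affIndep i) ,
      face-¬affIndep (tight i)

    tight-distinct : ∀ i j → SameSet (Face (tight i)) (Face (tight j)) → i ≡ j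
    tight-distinct i j same with i Fin.≟ j
    ... | yes i≡j = i≡j
    ... | no  i≢j = ⊥-elim (<-irrefl (proj₂ (proj₁ (same (facetPoint i j)) onFace-i))
                                     (facetPoint-strict i j (i≢j ∘ sym)))
      where
      onFace-i : Face (tight i) (facetPoint i j)
      onFace-i = facetPoint-∈P i j , facetPoint-onFacet i j

    tight-allFacets : ∀ h → IsFacet P h → FaceOf P h v → Σ (Fin n) λ i → SameSet (FaceOf P h) (Face (tight i))
    tight-allFacets h facet v∈F with facet-constraintFace h facet
    ... | C , F≈FC with tight-complete C (proj₂ (proj₁ (F≈FC v) v∈F))
    ...   | i , refl = i , F≈FC

    simpleAt : Σ (Fin n → Ineq n) λ fs →
      (∀ i → IsFacet P (fs i)) × (∀ i → FaceOf P (fs i) v) ×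
      (∀ i j → SameSet (FaceOf P (fs i)) (FaceOf P (fs j)) → i ≡ j) ×
      (∀ h → IsFacet P h → FaceOf P h v → Σ (Fin n) λ i → SameSet (FaceOf P h) (FaceOf P (fs i)))
    simpleAt = (λ i → normal (tight i) , bound (tight i)) , tight-isFacet , (λ i → v∈P , tight-isTight i) ,
               tight-distinct , tight-allFacets

  lower-tight⇒0 : ∀ x i → Tight x (lower i) → x i ≡ 0ℚ
  lower-tight⇒0 x i tight = trans (sym (neg-involutive (x i))) (cong -_ (trans (sym (lower-· i x)) tight))

  upper-tight⇒1 : ∀ x i → Tight x (upper i) → x i ≡ 1ℚ
  upper-tight⇒1 x i tight = trans (sym (upper-· i x)) tight

  lower-tight⇒¬fractional : ∀ x l i → Tight x (lower l) → Fractional (x i) → l ≢ i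
  lower-tight⇒¬fractional x l i tight (0<xi , _) refl = <-irrefl (sym (lower-tight⇒0 x l tight)) 0<xi

  upper-tight⇒¬fractional : ∀ x l i → Tight x (upper l) → Fractional (x i) → l ≢ i
  upper-tight⇒¬fractional x l i tight (_ , xi<1) refl = <-irrefl (upper-tight⇒1 x l tight) xi<1

  -- The bound constraint tight at a 0/1 coordinate, and the sign of the coordinate direction entering the cube.
  boundAt : Fin n → ∀ {x} → Is01 x → Constraint
  boundAt i (inj₁ _) = lower i
  boundAt i (inj₂ _) = upper i

  inward : ∀ {x} → Is01 x → ℚ
  inward (inj₁ _) = 1ℚ
  inward (inj₂ _) = - 1ℚ

  inward≢0 : ∀ {x} (b : Is01 x) → inward b ≢ 0ℚ
  inward≢0 (inj₁ _) ()
  inward≢0 (inj₂ _) ()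

  ·-boundAt : ∀ i {x} (b : Is01 x) y → normal (boundAt i b) · y ≡ - (inward b * y i)
  ·-boundAt i (inj₁ _) y = trans (lower-· i y) (cong -_ (sym (*-identityˡ (y i))))
  ·-boundAt i (inj₂ _) y = trans (upper-· i y) (solve 1 (λ z → z := :- (:- con 1ℚ :* z)) refl (y i))

  boundAt-tight : ∀ x i (b : Is01 (x i)) → Tight x (boundAt i b)
  boundAt-tight x i (inj₁ xi≡0) = trans (lower-· i x) (cong -_ xi≡0)
  boundAt-tight x i (inj₂ xi≡1) = trans (upper-· i x) xi≡1

  boundAt-lower : ∀ i {x} (b : Is01 x) → x ≡ 0ℚ → boundAt i b ≡ lower i
  boundAt-lower i (inj₁ _)    _    = refl
  boundAt-lower i (inj₂ x≡1) x≡0 = ⊥-elim (0≢1 (trans (sym x≡0) x≡1))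

  boundAt-upper : ∀ i {x} (b : Is01 x) → x ≡ 1ℚ → boundAt i b ≡ upper i
  boundAt-upper i (inj₂ _)    _    = refl
  boundAt-upper i (inj₁ x≡0) x≡1 = ⊥-elim (0≢1 (trans (sym x≡0) x≡1))

  boundAt-leaves : ∀ i {x} (b : Is01 x) (u : Point n) (s : ℚ) → s ≢ 0ℚ → u i ≡ inward b * (s * s) →
    normal (boundAt i b) · u < 0ℚ
  boundAt-leaves i b u s s≢0 ui≡ = subst (_< 0ℚ) (sym value) (neg-antimono-< (p≢0⇒0<p*p (inward b * s) σs≢0))
    where
    σs≢0 : inward b * s ≢ 0ℚ
    σs≢0 eq = s≢0 (p*q≡0⇒q≡0 (inward b) s eq (inward≢0 b))
    value : normal (boundAt i b) · u ≡ - ((inward b * s) * (inward b * s))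
    value = trans (·-boundAt i b u) (trans (cong (λ z → - (inward b * z)) ui≡)
      (solve 2 (λ σ s → :- (σ :* (σ :* (s :* s))) := :- ((σ :* s) :* (σ :* s))) refl (inward b) s))

  balanced : Fin n → Fin n → Point n
  balanced m k = g m ⊗ δ k ⊕ (- g k) ⊗ δ m

  g·balanced : ∀ m k → g · balanced m k ≡ 0ℚ
  g·balanced m k = trans (·-distrib-⊕ g (g m ⊗ δ k) ((- g k) ⊗ δ m))
    (trans (cong₂ _+_ (trans (·-⊗ g (g m) (δ k)) (cong (g m *_) (·-δ g k)))
                      (trans (·-⊗ g (- g k) (δ m)) (cong (- g k *_) (·-δ g m))))
           (solve 2 (λ a b → a :* b :+ (:- b) :* a := con 0ℚ) refl (g m) (g k)))

  balanced-outside : ∀ m k l → k ≢ l → m ≢ l → balanced m k l ≡ 0ℚ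
  balanced-outside m k l k≢l m≢l =
    trans (cong₂ (λ x y → g m * x + (- g k) * y) (δ-offDiag k≢l) (δ-offDiag m≢l))
          (solve 2 (λ a b → a :* con 0ℚ :+ b :* con 0ℚ := con 0ℚ) refl (g m) (- g k))

  balanced-at : ∀ m k → m ≢ k → balanced m k k ≡ g m
  balanced-at m k m≢k =
    trans (cong₂ (λ x y → g m * x + (- g k) * y) (δ-diag k) (δ-offDiag m≢k))
          (solve 2 (λ a b → a :* con 1ℚ :+ b :* con 0ℚ := a) refl (g m) (- g k))

  module Vertex {v : Point n} (vertex : IsVertex P v) where
    private
      a = proj₁ (proj₁ vertex)
      c = proj₂ (proj₁ vertex)
      valid : Valid P (a , c)
      valid = proj₁ (proj₂ vertex)
      av≡c : a · v ≡ c
      av≡c = proj₂ (proj₁ (proj₂ (proj₂ vertex)))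
      unique : ∀ x → FaceOf P (a , c) x → x ≡ v
      unique = proj₂ (proj₂ (proj₂ vertex))

    v∈P : P v
    v∈P = proj₁ (proj₁ (proj₂ (proj₂ vertex)))

    0≤v : ∀ i → 0ℚ ≤ v i
    0≤v i = proj₁ (P⊆Cube v v∈P i)

    v≤1 : ∀ i → v i ≤ 1ℚ
    v≤1 i = proj₂ (P⊆Cube v v∈P i)

    -- Moving along ±u keeps a · x ≤ c, hence a · u ≡ 0, so the moved point stays in the face {v}.
    rigid : ∀ u → (∀ C → Tight v C → normal C · u ≡ 0ℚ) → ∀ j → u j ≡ 0ℚ
    rigid u u-stays j = conclude
      (feasibleDirection v u v∈P (λ C tight → ≤-reflexive (u-stays C tight)))
      (feasibleDirection v ((- 1ℚ) ⊗ u) v∈P (λ C tight → ≤-reflexive (·-−u C tight)))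
      where
      ·-−u : ∀ C → Tight v C → normal C · ((- 1ℚ) ⊗ u) ≡ 0ℚ
      ·-−u C tight = trans (·-⊗ (normal C) (- 1ℚ) u) (trans (cong (- 1ℚ *_) (u-stays C tight)) (*-zeroʳ (- 1ℚ)))
      ·-moved : ∀ s w → a · (v ⊕ s ⊗ w) ≡ c + s * (a · w)
      ·-moved s w = trans (·-step a v s w) (cong (_+ s * (a · w)) av≡c)
      slope≤0 : ∀ {s w} → 0ℚ < s → P (v ⊕ s ⊗ w) → a · w ≤ 0ℚ
      slope≤0 {s} {w} 0<s moved∈P = 0<t∧c+ts≤c⇒s≤0 0<s (subst (_≤ c) (·-moved s w) (valid (v ⊕ s ⊗ w) moved∈P))
      conclude : (Σ ℚ λ t → 0ℚ < t × P (v ⊕ t ⊗ u)) → (Σ ℚ λ t → 0ℚ < t × P (v ⊕ t ⊗ ((- 1ℚ) ⊗ u))) → u j ≡ 0ℚ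
      conclude (t , 0<t , forward∈P) (t′ , 0<t′ , backward∈P) =
        p*q≡0⇒q≡0 t (u j) tuj≡0 (λ t≡0 → <-irrefl (sym t≡0) 0<t)
        where
        a·u≡0 : a · u ≡ 0ℚ
        a·u≡0 = ≤-antisym (slope≤0 {t} {u} 0<t forward∈P)
          (subst (0ℚ ≤_) (neg-involutive (a · u)) (neg-antimono-≤ (subst (_≤ 0ℚ)
            (trans (·-⊗ a (- 1ℚ) u) (solve 1 (λ z → :- con 1ℚ :* z := :- z) refl (a · u)))
            (slope≤0 {t′} {(- 1ℚ) ⊗ u} 0<t′ backward∈P))))
        forward≡v : v ⊕ t ⊗ u ≡ v
        forward≡v = unique (v ⊕ t ⊗ u) (forward∈P ,
          trans (·-moved t u) (trans (cong (λ z → c + t * z) a·u≡0) (trans (cong (c +_) (*-zeroʳ t)) (+-identityʳ c))))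
        tuj≡0 : t * u j ≡ 0ℚ
        tuj≡0 = p+q≡p⇒q≡0 (v j) (t * u j) (cong (λ x → x j) forward≡v)

    module SlackCut (slack : Strict v cut) where
      integral : ∀ j → ¬ Fractional (v j)
      integral j j-frac = 1≢0 (trans (sym (δ-diag j)) (rigid (δ j) stays j))
        where
        stays : ∀ C → Tight v C → normal C · δ j ≡ 0ℚ
        stays (lower i) tight = trans (lower-· i (δ j))
          (cong -_ (δ-offDiag (lower-tight⇒¬fractional v i j tight j-frac ∘ sym)))
        stays (upper i) tight = trans (upper-· i (δ j))
          (δ-offDiag (upper-tight⇒¬fractional v i j tight j-frac ∘ sym))
        stays cut tight = ⊥-elim (<-irrefl tight slack)

      bit : ∀ i → Is01 (v i)
      bit i = ¬fractional⇒01 (0≤v i) (v≤1 i) (integral i)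

      edge : Fin n → Point n
      edge k = inward (bit k) ⊗ δ k

      edge-stays : ∀ l k → l ≢ k → normal (boundAt l (bit l)) · edge k ≡ 0ℚ
      edge-stays l k l≢k = trans (·-boundAt l (bit l) (edge k))
        (trans (cong (λ z → - (inward (bit l) * (inward (bit k) * z))) (δ-offDiag (l≢k ∘ sym)))
               (solve 2 (λ a b → :- (a :* (b :* con 0ℚ)) := con 0ℚ) refl (inward (bit l)) (inward (bit k))))

      tight-complete : ∀ C → Tight v C → Σ (Fin n) λ i → boundAt i (bit i) ≡ C
      tight-complete (lower i) tight = i , boundAt-lower i (bit i) (lower-tight⇒0 v i tight)
      tight-complete (upper i) tight = i , boundAt-upper i (bit i) (upper-tight⇒1 v i tight)
      tight-complete cut       tight = ⊥-elim (<-irrefl tight slack)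

      nondegenerate : NondegenerateVertex v
      nondegenerate = record
        { v∈P            = v∈P
        ; tight          = λ i → boundAt i (bit i)
        ; tight-isTight  = λ i → boundAt-tight v i (bit i)
        ; tight-complete = tight-complete
        ; edge           = edge
        ; edge-stays     = edge-stays
        ; edge-leaves    = λ k → boundAt-leaves k (bit k) (edge k) 1ℚ (λ ())
                                   (cong (inward (bit k) *_) (δ-diag k))
        }

    module TightCut (onCut : Tight v cut) where
      fractionalCoordinate : Σ (Fin n) λ m → Fractional (v m)
      fractionalCoordinate with any? (λ j → fractional? (v j))
      ... | yes found = found
      ... | no  none  = ⊥-elim (cut-avoids-01 v (λ i → ¬fractional⇒01 (0≤v i) (v≤1 i) (λ frac → none (i , frac))) onCut)

      m : Fin n
      m = proj₁ fractionalCoordinate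

      m-fractional : Fractional (v m)
      m-fractional = proj₂ fractionalCoordinate

      -- Two fractional coordinates i, m would let v move along balanced m i inside the cut.
      uniqueFractional : ∀ i → i ≢ m → ¬ Fractional (v i)
      uniqueFractional i i≢m i-frac =
        g≢0 m (trans (sym (balanced-at m i (i≢m ∘ sym))) (rigid (balanced m i) stays i))
        where
        stays : ∀ C → Tight v C → normal C · balanced m i ≡ 0ℚ
        stays (lower l) tight = trans (lower-· l (balanced m i)) (cong -_ (balanced-outside m i l
          (lower-tight⇒¬fractional v l i tight i-frac ∘ sym) (lower-tight⇒¬fractional v l m tight m-fractional ∘ sym)))
        stays (upper l) tight = trans (upper-· l (balanced m i)) (balanced-outside m i l
          (upper-tight⇒¬fractional v l i tight i-frac ∘ sym) (upper-tight⇒¬fractional v l m tight m-fractional ∘ sym))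
        stays cut _ = g·balanced m i

      bit : ∀ i → i ≢ m → Is01 (v i)
      bit i i≢m = ¬fractional⇒01 (0≤v i) (v≤1 i) (uniqueFractional i i≢m)

      tightAt : ∀ i → Dec (i ≡ m) → Constraint
      tightAt i (yes _)   = cut
      tightAt i (no  i≢m) = boundAt i (bit i i≢m)

      edgeAt : ∀ k → Dec (k ≡ m) → Point n
      edgeAt k (yes _)   = (- g m) ⊗ δ m
      edgeAt k (no  k≢m) = (inward (bit k k≢m) * g m) ⊗ balanced m k

      tightAt-isTight : ∀ i (i≟m : Dec (i ≡ m)) → Tight v (tightAt i i≟m)
      tightAt-isTight i (yes _)   = onCut
      tightAt-isTight i (no  i≢m) = boundAt-tight v i (bit i i≢m)

      edgeAt-stays : ∀ l k → l ≢ k → (l≟m : Dec (l ≡ m)) (k≟m : Dec (k ≡ m)) →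
        normal (tightAt l l≟m) · edgeAt k k≟m ≡ 0ℚ
      edgeAt-stays l k l≢k (yes l≡m) (yes k≡m) = ⊥-elim (l≢k (trans l≡m (sym k≡m)))
      edgeAt-stays l k l≢k (yes _)   (no  k≢m) = trans (·-⊗ g s (balanced m k))
        (trans (cong (s *_) (g·balanced m k)) (*-zeroʳ s))
        where
        s = inward (bit k k≢m) * g m
      edgeAt-stays l k l≢k (no  l≢m) (yes _)   = trans (·-boundAt l (bit l l≢m) ((- g m) ⊗ δ m))
        (trans (cong (λ z → - (σ * (- g m * z))) (δ-offDiag (l≢m ∘ sym)))
               (solve 2 (λ σ a → :- (σ :* (a :* con 0ℚ)) := con 0ℚ) refl σ (- g m)))
        where
        σ = inward (bit l l≢m)
      edgeAt-stays l k l≢k (no  l≢m) (no  k≢m) = trans (·-boundAt l (bit l l≢m) (edgeAt k (no k≢m)))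
        (trans (cong (λ z → - (σ * (s * z))) (balanced-outside m k l (l≢k ∘ sym) (l≢m ∘ sym)))
               (solve 2 (λ σ s → :- (σ :* (s :* con 0ℚ)) := con 0ℚ) refl σ s))
        where
        σ = inward (bit l l≢m)
        s = inward (bit k k≢m) * g m

      edgeAt-leaves : ∀ k (k≟m : Dec (k ≡ m)) → normal (tightAt k k≟m) · edgeAt k k≟m < 0ℚ
      edgeAt-leaves k (yes _) = subst (_< 0ℚ) (sym value) (neg-antimono-< (p≢0⇒0<p*p (g m) (g≢0 m)))
        where
        value : g · ((- g m) ⊗ δ m) ≡ - (g m * g m)
        value = trans (·-⊗ g (- g m) (δ m)) (trans (cong (- g m *_) (·-δ g m)) (sym (neg-distribˡ-* (g m) (g m))))
      edgeAt-leaves k (no k≢m) = boundAt-leaves k (bit k k≢m) (edgeAt k (no k≢m)) (g m) (g≢0 m)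
        (trans (cong (s *_) (balanced-at m k (k≢m ∘ sym))) (*-assoc (inward (bit k k≢m)) (g m) (g m)))
        where
        s = inward (bit k k≢m) * g m

      tightAt-lower : ∀ i (i≟m : Dec (i ≡ m)) → v i ≡ 0ℚ → tightAt i i≟m ≡ lower i
      tightAt-lower i (yes refl) vi≡0 = ⊥-elim (<-irrefl (sym vi≡0) (proj₁ m-fractional))
      tightAt-lower i (no  i≢m)  vi≡0 = boundAt-lower i (bit i i≢m) vi≡0

      tightAt-upper : ∀ i (i≟m : Dec (i ≡ m)) → v i ≡ 1ℚ → tightAt i i≟m ≡ upper i
      tightAt-upper i (yes refl) vi≡1 = ⊥-elim (<-irrefl vi≡1 (proj₂ m-fractional))
      tightAt-upper i (no  i≢m)  vi≡1 = boundAt-upper i (bit i i≢m) vi≡1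

      tightAt-cut : (m≟m : Dec (m ≡ m)) → tightAt m m≟m ≡ cut
      tightAt-cut (yes _)   = refl
      tightAt-cut (no  m≢m) = ⊥-elim (m≢m refl)

      tight-complete : ∀ C → Tight v C → Σ (Fin n) λ i → tightAt i (i Fin.≟ m) ≡ C
      tight-complete (lower i) tight = i , tightAt-lower i (i Fin.≟ m) (lower-tight⇒0 v i tight)
      tight-complete (upper i) tight = i , tightAt-upper i (i Fin.≟ m) (upper-tight⇒1 v i tight)
      tight-complete cut       _     = m , tightAt-cut (m Fin.≟ m)

      nondegenerate : NondegenerateVertex v
      nondegenerate = record
        { v∈P            = v∈P
        ; tight          = λ i → tightAt i (i Fin.≟ m)
        ; tight-isTight  = λ i → tightAt-isTight i (i Fin.≟ m)
        ; tight-complete = tight-complete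
        ; edge           = λ k → edgeAt k (k Fin.≟ m)
        ; edge-stays     = λ l k l≢k → edgeAt-stays l k l≢k (l Fin.≟ m) (k Fin.≟ m)
        ; edge-leaves    = λ k → edgeAt-leaves k (k Fin.≟ m)
        }

    nondegenerate : NondegenerateVertex v
    nondegenerate with tight? v cut
    ... | yes onCut  = TightCut.nondegenerate onCut
    ... | no  offCut = SlackCut.nondegenerate (≤∧≢⇒< (v∈P cut) offCut)

  P-simple : IsSimple P
  P-simple v vertex = NondegenerateVertexFacets.simpleAt (Vertex.nondegenerate vertex)

SameSet-sym : ∀ {D} {S T : Region D} → SameSet S T → SameSet T S
SameSet-sym S≈T x = proj₂ (S≈T x) , proj₁ (S≈T x)

SameSet-trans : ∀ {D} {S T U : Region D} → SameSet S T → SameSet T U → SameSet S U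
SameSet-trans S≈T T≈U x = proj₁ (T≈U x) ∘ proj₁ (S≈T x) , proj₂ (S≈T x) ∘ proj₂ (T≈U x)

FaceOf-cong : ∀ {D} {P Q : Region D} (h : Ineq D) → SameSet P Q → SameSet (FaceOf P h) (FaceOf Q h)
FaceOf-cong h P≈Q x = (λ { (x∈P , on) → proj₁ (P≈Q x) x∈P , on }) , (λ { (x∈Q , on) → proj₂ (P≈Q x) x∈Q , on })

HasAffIndep-mono : ∀ {D m} {S T : Region D} → (∀ x → S x → T x) → HasAffIndep S m → HasAffIndep T m
HasAffIndep-mono S⊆T (p , p∈S , indep) = p , (λ i → S⊆T (p i) (p∈S i)) , indep

HasDim-cong : ∀ {D k} {S T : Region D} → SameSet S T → HasDim S k → HasDim T k
HasDim-cong S≈T (indep , ¬indep) =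
  HasAffIndep-mono (λ x → proj₁ (S≈T x)) indep , ¬indep ∘ HasAffIndep-mono (λ x → proj₂ (S≈T x))

Valid-cong : ∀ {D} {P Q : Region D} (h : Ineq D) → SameSet P Q → Valid P h → Valid Q h
Valid-cong h P≈Q valid x x∈Q = valid x (proj₂ (P≈Q x) x∈Q)

IsFacet-cong : ∀ {D} {P Q : Region D} (h : Ineq D) → SameSet P Q → IsFacet P h → IsFacet Q h
IsFacet-cong {zero}  h P≈Q (_ , _ , ())
IsFacet-cong {suc D} h P≈Q (valid , dim) = Valid-cong h P≈Q valid , HasDim-cong (FaceOf-cong h P≈Q) dim

IsVertex-cong : ∀ {D} {P Q : Region D} (v : Point D) → SameSet P Q → IsVertex P v → IsVertex Q v
IsVertex-cong v P≈Q (h , valid , v∈F , unique) =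
  h , Valid-cong h P≈Q valid , proj₁ (FaceOf-cong h P≈Q v) v∈F ,
  λ x x∈F → unique x (proj₂ (FaceOf-cong h P≈Q x) x∈F)

IsSimple-cong : ∀ {D} {P Q : Region D} → SameSet P Q → IsSimple P → IsSimple Q
IsSimple-cong {P = P} {Q} P≈Q simple v vertex
  with simple v (IsVertex-cong v (SameSet-sym P≈Q) vertex)
... | fs , facet , v∈F , distinct , complete =
  fs , (λ i → IsFacet-cong (fs i) P≈Q (facet i)) , (λ i → proj₁ (FaceOf-cong (fs i) P≈Q v) (v∈F i)) ,
  (λ i j same → distinct i j (conj (fs i) (fs j) (SameSet-sym P≈Q) same)) ,
  λ h h-facet v∈h → let (i , same) = complete h (IsFacet-cong h (SameSet-sym P≈Q) h-facet)
                                              (proj₂ (FaceOf-cong h P≈Q v) v∈h)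
                    in i , conj h (fs i) P≈Q same
  where
  conj : ∀ {S T : Region _} h h′ → SameSet S T → SameSet (FaceOf S h) (FaceOf S h′) → SameSet (FaceOf T h) (FaceOf T h′)
  conj h h′ S≈T same = SameSet-trans (FaceOf-cong h (SameSet-sym S≈T)) (SameSet-trans same (FaceOf-cong h′ S≈T))

-- The polytope P_b

fromℚᵘ-homo-+ : ∀ p q → fromℚᵘ (p ℚᵘ.+ q) ≡ fromℚᵘ p + fromℚᵘ q
fromℚᵘ-homo-+ p q = toℚᵘ-injective (ℚᵘ.≃-trans (toℚᵘ-fromℚᵘ (p ℚᵘ.+ q))
  (ℚᵘ.≃-sym (ℚᵘ.≃-trans (toℚᵘ-homo-+ (fromℚᵘ p) (fromℚᵘ q)) (ℚᵘ.+-cong (toℚᵘ-fromℚᵘ p) (toℚᵘ-fromℚᵘ q)))))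

/1≡toℚ : ∀ k → ℤ.+ k / 1 ≡ toℚ k
/1≡toℚ zero    = refl
/1≡toℚ (suc k) =
  trans (fromℚᵘ-cong {ℚᵘ.mkℚᵘ (ℤ.+ suc k) 0} {ℚᵘ.mkℚᵘ (ℤ.+ 1) 0 ℚᵘ.+ ℚᵘ.mkℚᵘ (ℤ.+ k) 0} (ℚᵘ.*≡* cross))
        (trans (fromℚᵘ-homo-+ (ℚᵘ.mkℚᵘ (ℤ.+ 1) 0) (ℚᵘ.mkℚᵘ (ℤ.+ k) 0)) (cong (1ℚ +_) (/1≡toℚ k)))
  where
  cross : ℤ.+ suc k ℤ.* ℤ.+ 1 ≡ (ℤ.+ 1 ℤ.* ℤ.+ 1 ℤ.+ ℤ.+ k ℤ.* ℤ.+ 1) ℤ.* ℤ.+ 1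
  cross = trans (ℤ.*-identityʳ (ℤ.+ suc k))
    (sym (trans (ℤ.*-identityʳ _) (cong (ℤ._+_ (ℤ.+ 1)) (ℤ.*-identityʳ (ℤ.+ k)))))

[2q]/2≡toℚ : ∀ q → ℤ.+ (q ℕ.* 2) / 2 ≡ toℚ q
[2q]/2≡toℚ q = trans (fromℚᵘ-cong {ℚᵘ.mkℚᵘ (ℤ.+ (q ℕ.* 2)) 1} {ℚᵘ.mkℚᵘ (ℤ.+ q) 0} (ℚᵘ.*≡* cross)) (/1≡toℚ q)
  where
  cross : ℤ.+ (q ℕ.* 2) ℤ.* ℤ.+ 1 ≡ ℤ.+ q ℤ.* ℤ.+ 2
  cross = trans (ℤ.*-identityʳ (ℤ.+ (q ℕ.* 2))) (ℤ.pos-* q 2)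

∑-toℚ : ∀ {m} (u : Fin m → ℕ) → ∑ (λ i → toℚ (u i)) ≡ toℚ (∑ℕ u)
∑-toℚ {zero}  u = refl
∑-toℚ {suc m} u = trans (cong (toℚ (u zero) +_) (∑-toℚ (u ∘ suc))) (sym (toℚ-+ (u zero) (∑ℕ (u ∘ suc))))

¼ ½ : ℚ
¼ = ℤ.+ 1 / 4
½ = ℤ.+ 1 / 2

0<¼ : 0ℚ < ¼
0<¼ = *<* (ℤ.+<+ (ℕ.s≤s ℕ.z≤n))

0<½ : 0ℚ < ½
0<½ = *<* (ℤ.+<+ (ℕ.s≤s ℕ.z≤n))

¼<1 : ¼ < 1ℚ
¼<1 = *<* (ℤ.+<+ (ℕ.s≤s (ℕ.s≤s ℕ.z≤n)))

toℚ+¼≢toℚ : ∀ A C → toℚ A + ¼ ≢ toℚ C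
toℚ+¼≢toℚ A C eq with C ℕ.≤? A
... | yes C≤A = <-irrefl (sym eq) (≤-<-trans (toℚ-mono-≤ C≤A)
                  (subst (_< toℚ A + ¼) (+-identityʳ (toℚ A)) (+-monoʳ-< (toℚ A) 0<¼)))
... | no  C≰A = <-irrefl eq (<-≤-trans
                  (subst (toℚ A + ¼ <_) (+-comm (toℚ A) 1ℚ) (+-monoʳ-< (toℚ A) ¼<1)) (toℚ-mono-≤ (ℕ.≰⇒> C≰A)))

infixl 5 _∷ʳ_
_∷ʳ_ : ∀ {m} {A : Set} → (Fin m → A) → A → Fin (suc m) → A
_∷ʳ_ {zero}  xs x zero    = x
_∷ʳ_ {suc m} xs x zero    = xs zero
_∷ʳ_ {suc m} xs x (suc i) = ((xs ∘ suc) ∷ʳ x) i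

∷ʳ-inject₁ : ∀ {m} {A : Set} (xs : Fin m → A) x i → (xs ∷ʳ x) (inject₁ i) ≡ xs i
∷ʳ-inject₁ {suc m} xs x zero    = refl
∷ʳ-inject₁ {suc m} xs x (suc i) = ∷ʳ-inject₁ (xs ∘ suc) x i

∷ʳ-last : ∀ {m} {A : Set} (xs : Fin m → A) x → (xs ∷ʳ x) (Fin.fromℕ m) ≡ x
∷ʳ-last {zero}  xs x = refl
∷ʳ-last {suc m} xs x = ∷ʳ-last (xs ∘ suc) x

∷ʳ-all : ∀ {m} {A : Set} (Q : A → Set) (xs : Fin m → A) x → (∀ i → Q (xs i)) → Q x → ∀ j → Q ((xs ∷ʳ x) j)
∷ʳ-all {zero}  Q xs x Qxs Qx zero    = Qx
∷ʳ-all {suc m} Q xs x Qxs Qx zero    = Qxs zero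
∷ʳ-all {suc m} Q xs x Qxs Qx (suc j) = ∷ʳ-all Q (xs ∘ suc) x (Qxs ∘ suc) Qx j

select : ∀ {y} → Is01 y → ℕ → ℕ
select (inj₁ _) k = 0
select (inj₂ _) k = k

/1*01≡toℚ : ∀ k {y} (bit : Is01 y) → (ℤ.+ k / 1) * y ≡ toℚ (select bit k)
/1*01≡toℚ k (inj₁ refl) = *-zeroʳ (ℤ.+ k / 1)
/1*01≡toℚ k (inj₂ refl) = trans (*-identityʳ (ℤ.+ k / 1)) (/1≡toℚ k)

-- The four corners (x_{d+1}, x_{d+2}) ∈ {0,1}² each reduce the cut equation to A + ¼ = C for naturals A, C.
cornerValue≢ : ∀ N q {y₁ y₂} → Is01 y₁ → Is01 y₂ → toℚ N - toℚ q * y₁ + (toℚ q + ½) * y₂ ≢ toℚ q + ¼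
cornerValue≢ N q (inj₁ refl) (inj₁ refl) eq = toℚ+¼≢toℚ q N (trans (sym eq)
  (solve 3 (λ n q f → n :- q :* con 0ℚ :+ (q :+ (f :+ f)) :* con 0ℚ := n) refl (toℚ N) (toℚ q) ¼))
cornerValue≢ N q (inj₂ refl) (inj₁ refl) eq = toℚ+¼≢toℚ (q ℕ.+ q) N
  (trans (cong (_+ ¼) (toℚ-+ q q))
  (trans (solve 2 (λ q f → (q :+ q) :+ f := q :+ (q :+ f)) refl (toℚ q) ¼)
  (trans (cong (toℚ q +_) (sym eq))
         (solve 3 (λ n q f → q :+ (n :- q :* con 1ℚ :+ (q :+ (f :+ f)) :* con 0ℚ) := n) refl (toℚ N) (toℚ q) ¼))))
cornerValue≢ N q (inj₁ refl) (inj₂ refl) eq = toℚ+¼≢toℚ N 0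
  (trans (solve 3 (λ n q f → n :+ f := (n :- q :* con 0ℚ :+ (q :+ (f :+ f)) :* con 1ℚ) :- (q :+ f)) refl (toℚ N) (toℚ q) ¼)
  (trans (cong (_- (toℚ q + ¼)) eq) (+-inverseʳ (toℚ q + ¼))))
cornerValue≢ N q (inj₂ refl) (inj₂ refl) eq = toℚ+¼≢toℚ N q
  (trans (solve 3 (λ n q f → n :+ f := (n :- q :* con 1ℚ :+ (q :+ (f :+ f)) :* con 1ℚ) :- f) refl (toℚ N) (toℚ q) ¼)
  (trans (cong (_- ¼) eq) (solve 2 (λ q f → q :+ f :- f := q) refl (toℚ q) ¼)))

module Pb-asCubeCut (d : ℕ) (d≥1 : d ≥ 1) (b : Fin d → ℕ) (b>0 : ∀ i → b i > 0)
                    (q : ℕ) (∑b≡q*2 : ∑ℕ b ≡ q ℕ.* 2) where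

  β≡q : β b ≡ toℚ q
  β≡q = trans (cong (λ s → ℤ.+ s / 2) ∑b≡q*2) ([2q]/2≡toℚ q)

  0<β : 0ℚ < β b
  0<β = subst (0ℚ <_) (sym β≡q) (0<toℚq q ∑b≡q*2)
    where
    ∑b>0 : ∀ {d} → d ≥ 1 → (b : Fin d → ℕ) → (∀ i → b i > 0) → ∑ℕ b > 0
    ∑b>0 (ℕ.s≤s _) b b>0 = ℕ.<-≤-trans (b>0 zero) (ℕ.m≤m+n (b zero) _)
    0<toℚq : ∀ q → ∑ℕ b ≡ q ℕ.* 2 → 0ℚ < toℚ q
    0<toℚq zero     ∑b≡0 = ⊥-elim (ℕ.<-irrefl (sym ∑b≡0) (∑b>0 d≥1 b b>0))
    0<toℚq (suc q′) _    = toℚ-pos q′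

  0<β+ : ∀ {s} → 0ℚ < s → 0ℚ < β b + s
  0<β+ {s} 0<s = subst (_< β b + s) (+-identityˡ 0ℚ) (+-mono-< 0<β 0<s)

  coeff : Fin d → ℚ
  coeff i = ℤ.+ b i / 1

  g : Point (suc (suc d))
  g = (coeff ∷ʳ - β b) ∷ʳ (β b + ½)

  r : ℚ
  r = β b + ¼

  g≢0 : ∀ j → g j ≢ 0ℚ
  g≢0 = ∷ʳ-all (_≢ 0ℚ) (coeff ∷ʳ - β b) (β b + ½)
          (∷ʳ-all (_≢ 0ℚ) coeff (- β b) coeff≢0 (λ eq → <-irrefl (sym (trans (sym (neg-involutive (β b))) (cong -_ eq))) 0<β))
          (λ eq → <-irrefl (sym eq) (0<β+ 0<½))
    where
    coeff≢0 : ∀ i → coeff i ≢ 0ℚ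
    coeff≢0 i eq with b i | b>0 i | /1≡toℚ (b i)
    ... | suc k | _ | /1≡ = <-irrefl (sym (trans (sym /1≡) eq)) (toℚ-pos k)

  xᵢ : Fin d → Fin (suc (suc d))
  xᵢ i = inject₁ (inject₁ i)

  g·x≡ : ∀ (x : Point (suc (suc d))) →
    g · x ≡ ∑ (λ i → (ℤ.+ b i / 1) * x (xᵢ i)) - β b * x (inject₁ (Fin.fromℕ d)) + (β b + ½) * x (Fin.fromℕ (suc d))
  g·x≡ x = trans (∑-init-last (λ j → g j * x j))
    (cong₂ _+_ (trans (∑-init-last (λ j → g (inject₁ j) * x (inject₁ j)))
                 (cong₂ _+_ (∑-cong (λ i → cong (_* x (xᵢ i))
                                (trans (∷ʳ-inject₁ (coeff ∷ʳ - β b) (β b + ½) (inject₁ i)) (∷ʳ-inject₁ coeff (- β b) i))))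
                            (trans (cong (_* x (inject₁ (Fin.fromℕ d)))
                                     (trans (∷ʳ-inject₁ (coeff ∷ʳ - β b) (β b + ½) (Fin.fromℕ d)) (∷ʳ-last coeff (- β b))))
                                   (sym (neg-distribˡ-* (β b) (x (inject₁ (Fin.fromℕ d))))))))
               (cong (_* x (Fin.fromℕ (suc d))) (∷ʳ-last (coeff ∷ʳ - β b) (β b + ½))))

  cut-avoids-01 : ∀ x → (∀ i → Is01 (x i)) → g · x ≢ r
  cut-avoids-01 x bits eq =
    cornerValue≢ (∑ℕ selected) q (bits (inject₁ (Fin.fromℕ d))) (bits (Fin.fromℕ (suc d)))
      (trans (sym (cong₂ (λ s t → s - t * x (inject₁ (Fin.fromℕ d)) + (t + ½) * x (Fin.fromℕ (suc d))) ∑≡ β≡q))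
             (trans (sym (g·x≡ x)) (trans eq (cong (_+ ¼) β≡q))))
    where
    selected : Fin d → ℕ
    selected i = select (bits (xᵢ i)) (b i)
    ∑≡ : ∑ (λ i → (ℤ.+ b i / 1) * x (xᵢ i)) ≡ toℚ (∑ℕ selected)
    ∑≡ = trans (∑-cong (λ i → /1*01≡toℚ (b i) (bits (xᵢ i)))) (∑-toℚ selected)

  open CubeCut g r g≢0 (0<β+ 0<¼) cut-avoids-01 public

  P≈Pb : SameSet P (Pb d b)
  P≈Pb x = from , to
    where
    to : Pb d b x → P x
    to (cube , cut≤) (lower i) = subst (_≤ 0ℚ) (sym (lower-· i x)) (neg-antimono-≤ (proj₁ (cube i)))
    to (cube , cut≤) (upper i) = subst (_≤ 1ℚ) (sym (upper-· i x)) (proj₂ (cube i))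
    to (cube , cut≤) cut       = subst (_≤ r) (sym (g·x≡ x)) cut≤
    from : P x → Pb d b x
    from x∈P = P⊆Cube x x∈P , subst (_≤ r) (g·x≡ x) (x∈P cut)

lemma2p1 : (d : ℕ) → d ≥ 1 → (b : Fin d → ℕ) → (∀ i → b i > 0) → 2 ∣ ∑ℕ b →
    HasDim (Pb d b) (suc (suc d)) × IsSimple (Pb d b)
lemma2p1 d d≥1 b b>0 (divides q ∑b≡q*2) =
  HasDim-cong P≈Pb P-fullDim , IsSimple-cong P≈Pb P-simple
  where open Pb-asCubeCut d d≥1 b b>0 q ∑b≡q*2
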